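{- Let $G$ be a bipartite graph and $k$ a positive integer. Then $G$ admits a strongly $k$-uniform integer additive set-indexer which is not a weakly $k$-uniform integer additive set-indexer if and only if $k$ is a composite integer.
   Context: All graphs are simple, finite and have no isolated vertices (so $G$ has at least one edge). Set-labels are non-empty finite subsets of the non-negative integers $\mathbb{N}_0$. For sets $A,B$, $A+B=\{a+b: a\in A, b\in B\}$. An integer additive set-indexer (IASI) of $G$ is an injective $f:V(G)\to 2^{\mathbb{N}_0}$ such that $f^+:E(G)\to 2^{\mathbb{N}_0}$, $f^+(uv)=f(u)+f(v)$, is injective. An IASI is $k$-uniform if $|f^+(e)|=k$ for all edges $e$. It is strong if $|f^+(uv)|=|f(u)|\,|f(v)|$ for every edge $uv$, and strongly $k$-uniform if it is strong and $k$-uniform. It is weak if $|f^+(uv)|=\max(|f(u)|,|f(v)|)$ for every edge $uv$, and weakly $k$-uniform if it is weak and $k$-uniform. -}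

module Defs where

open import Data.Nat using (ℕ; _+_; _*_; _⊔_; _≟_)
open import Data.Fin using (Fin)
open import Data.Bool using (Bool)
open import Data.List using (List; []; length; map; concatMap; deduplicate)
open import Data.List.Membership.Propositional using (_∈_)
open import Data.Product using (Σ; ∃; _×_)
open import Data.Sum using (_⊎_)
open import Function.Bundles using (_⇔_)
open import Relation.Binary.PropositionalEquality using (_≡_; _≢_)
open import Relation.Nullary using (¬_)

record Graph : Set₁ where
  field
    n        : ℕ
    Adj      : Fin n → Fin n → Set
    sym      : ∀ {u v} → Adj u v → Adj v u
    irrefl   : ∀ {u} → ¬ Adj u u
    noIsol   : ∀ u → ∃ λ v → Adj u v
    hasEdge  : ∃ λ u → ∃ λ v → Adj u v
open Graph public

Bipartite : Graph → Set
Bipartite G = Σ (Fin (n G) → Bool) λ c → ∀ u v → Adj G u v → c u ≢ c v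

-- A finite subset of ℕ₀ is represented by a list; the set is its set of elements.
_≈ˢ_ : List ℕ → List ℕ → Set
A ≈ˢ B = ∀ x → (x ∈ A) ⇔ (x ∈ B)

card : List ℕ → ℕ
card A = length (deduplicate _≟_ A)

_⊕_ : List ℕ → List ℕ → List ℕ
A ⊕ B = concatMap (λ a → map (a +_) B) A

module _ (G : Graph) where
  private V = Fin (n G)

  IsIASI : (V → List ℕ) → Set
  IsIASI f =
    (∀ v → f v ≢ [])
    × (∀ u v → f u ≈ˢ f v → u ≡ v)
    × (∀ u v u' v' → Adj G u v → Adj G u' v' →
         (f u ⊕ f v) ≈ˢ (f u' ⊕ f v') →
         (u ≡ u' × v ≡ v') ⊎ (u ≡ v' × v ≡ u'))

  Uniform : ℕ → (V → List ℕ) → Set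
  Uniform k f = ∀ u v → Adj G u v → card (f u ⊕ f v) ≡ k

  Strong : (V → List ℕ) → Set
  Strong f = ∀ u v → Adj G u v → card (f u ⊕ f v) ≡ card (f u) * card (f v)

  Weak : (V → List ℕ) → Set
  Weak f = ∀ u v → Adj G u v → card (f u ⊕ f v) ≡ card (f u) ⊔ card (f v)

  StronglyUniformIASI : ℕ → (V → List ℕ) → Set
  StronglyUniformIASI k f = IsIASI f × Strong f × Uniform k f

  WeaklyUniformIASI : ℕ → (V → List ℕ) → Set
  WeaklyUniformIASI k f = IsIASI f × Weak f × Uniform k f

-- If a k-uniform IASI is strong, k = |f u| · |f v| on every edge; when k is not
-- composite one factor is 1, so |f u| · |f v| = max (|f u|, |f v|) and the IASI is
-- weak as well. Conversely, for k = a · b with a, b ≥ 2, label the vertex with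
-- index x < N by the interval [x, x + a) on one side of the bipartition and by
-- the progression (x + 1) N + a·[0, b) on the other. Along an edge all a · b sums
-- are distinct (base-a digits), so the labelling is strongly k-uniform, and not
-- weak since a · b > max (a, b). Minima of labels, and of edge sums
-- x + (y + 1) N, are distinct by division with remainder by N, which gives the
-- injectivity required of an IASI.
module Submission where

open import Defs
open import Data.Nat using (ℕ; _≥_)
open import Data.Fin using (Fin)
open import Data.List using (List)
open import Data.Product using (Σ; _×_)
open import Data.Nat.Primality using (Composite)
open import Function.Bundles using (_⇔_)
open import Relation.Nullary using (¬_)

open import Data.Nat
  using (suc; _+_; _*_; _⊔_; _≤_; _<_; _≟_; s≤s; z≤n; z<s; NonZero; >-nonZero; nonTrivial⇒n>1)
open import Data.Nat.Properties
open import Data.Nat.DivMod using (_%_; [m+kn]%n≡m%n; m<n⇒m%n≡m)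
open import Data.Nat.Divisibility using (m∣m*n; quotient; quotient>1; m∣n⇒n≡quotient*m)
open import Data.Nat.Primality using (composite; composite-≢; composite?)
open import Data.Nat.Tactic.RingSolver using (solve-∀)
open import Data.Bool using (Bool; true; false)
open import Data.Empty using (⊥)
open import Data.Fin using (toℕ)
open import Data.Fin.Properties using (toℕ<n; toℕ-injective)
open import Data.List
  using ([]; _∷_; _++_; map; filter; length; applyUpTo; deduplicate; cartesianProductWith)
open import Data.List.Properties using (length-++; length-map; length-applyUpTo; filter-all)
open import Data.List.Membership.Propositional using (_∈_)
open import Data.List.Membership.Propositional.Properties
  using (∈-map⁻; ∈-applyUpTo⁻; ∈-cartesianProductWith⁺; ∈-cartesianProductWith⁻)
open import Data.List.Relation.Unary.Any using (here; there)
open import Data.List.Relation.Unary.All using (lookup)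
open import Data.List.Relation.Unary.AllPairs using ([]; _∷_)
open import Data.List.Relation.Unary.Unique.Propositional using (Unique)
open import Data.List.Relation.Unary.Unique.Propositional.Properties
  using (++⁺; map⁺; applyUpTo⁺₁)
open import Data.Product using (_,_; proj₁; proj₂; ∃₂; map₂; swap)
open import Data.Product using () renaming (map to map-×)
open import Data.Sum using (_⊎_; inj₁; inj₂)
open import Data.Sum using () renaming (map to map-⊎)
open import Function.Bundles using (mk⇔; Equivalence)
open import Function.Base using (case_of_)
open import Relation.Nullary using (¬?; contradiction)
open import Relation.Nullary.Decidable using (decidable-stable)
open import Relation.Binary.PropositionalEquality
  using (_≡_; _≢_; refl; trans; cong; cong₂; subst; module ≡-Reasoning)
  renaming (sym to ≡-sym)

private
  variable
    d r r' q q' x y x' y' : ℕ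
    A B : List ℕ

divMod-unique : r < d → r' < d → r + q * d ≡ r' + q' * d → r ≡ r' × q ≡ q'
divMod-unique {r} {d} {r'} {q} {q'} r<d r'<d eq = r≡r' , q≡q'
  where
  instance _ = >-nonZero (≤-<-trans z≤n r<d)
  open ≡-Reasoning
  r≡r' : r ≡ r'
  r≡r' = begin
    r                 ≡⟨ m<n⇒m%n≡m r<d ⟨
    r % d             ≡⟨ [m+kn]%n≡m%n r q d ⟨
    (r + q * d) % d   ≡⟨ cong (_% d) eq ⟩
    (r' + q' * d) % d ≡⟨ [m+kn]%n≡m%n r' q' d ⟩
    r' % d            ≡⟨ m<n⇒m%n≡m r'<d ⟩
    r'                ∎
  q≡q' : q ≡ q'
  q≡q' = *-cancelʳ-≡ q q' d (+-cancelˡ-≡ r _ _ (trans eq (cong (_+ q' * d) (≡-sym r≡r'))))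

m⊔n<m*n : ∀ {m n} → 1 < m → 1 < n → m ⊔ n < m * n
m⊔n<m*n {m@(suc _)} {n@(suc _)} 1<m 1<n =
  ⊔-lub (m<m*n m n 1<n) (subst (n <_) (*-comm n m) (m<m*n n m 1<m))

¬composite⇒m*n≡m⊔n : ∀ m n .{{_ : NonZero m}} .{{_ : NonZero n}} →
                      ¬ Composite (m * n) → m * n ≡ m ⊔ n
¬composite⇒m*n≡m⊔n 1               n@(suc _)       _  = *-identityˡ n
¬composite⇒m*n≡m⊔n m@(suc (suc _)) 1               _  = *-identityʳ m
¬composite⇒m*n≡m⊔n m@(suc (suc _)) n@(suc (suc _)) ¬c =
  contradiction (composite-≢ m (<⇒≢ (m<m*n m n (s≤s (s≤s z≤n)))) (m∣m*n n)) ¬c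

composite⇒nontrivial-product : ∀ {n} → Composite n → ∃₂ λ a b → 1 < a × 1 < b × a * b ≡ n
composite⇒nontrivial-product (composite {d} d<n d∣n) =
  quotient d∣n , d , quotient>1 d∣n d<n , nonTrivial⇒n>1 d , ≡-sym (m∣n⇒n≡quotient*m d∣n)

record IsLeast (m : ℕ) (A : List ℕ) : Set where
  field
    least-∈ : m ∈ A
    least-≤ : ∀ {x} → x ∈ A → m ≤ x
open IsLeast

IsLeast⇒≢[] : ∀ {m} → IsLeast m A → A ≢ []
IsLeast⇒≢[] least refl with least-∈ least
... | ()

IsLeast-unique : ∀ {m m'} → A ≈ˢ B → IsLeast m A → IsLeast m' B → m ≡ m'
IsLeast-unique A≈B least least' = ≤-antisym
  (least-≤ least (Equivalence.from (A≈B _) (least-∈ least')))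
  (least-≤ least' (Equivalence.to (A≈B _) (least-∈ least)))

⊕≡cartesianProductWith : ∀ A B → A ⊕ B ≡ cartesianProductWith _+_ A B
⊕≡cartesianProductWith []      B = refl
⊕≡cartesianProductWith (a ∷ A) B = cong (map (a +_) B ++_) (⊕≡cartesianProductWith A B)

∈-⊕⁺ : x ∈ A → y ∈ B → x + y ∈ A ⊕ B
∈-⊕⁺ {A = A} {B = B} x∈A y∈B
  rewrite ⊕≡cartesianProductWith A B = ∈-cartesianProductWith⁺ _+_ x∈A y∈B

∈-⊕⁻ : ∀ A B {z} → z ∈ A ⊕ B → ∃₂ λ x y → x ∈ A × y ∈ B × z ≡ x + y
∈-⊕⁻ A B z∈A⊕B
  rewrite ⊕≡cartesianProductWith A B = ∈-cartesianProductWith⁻ _+_ A B z∈A⊕B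

IsLeast-⊕ : ∀ {m m'} → IsLeast m A → IsLeast m' B → IsLeast (m + m') (A ⊕ B)
IsLeast-⊕ {A = A} {B = B} {m} {m'} least least' = record
  { least-∈ = ∈-⊕⁺ (least-∈ least) (least-∈ least')
  ; least-≤ = λ z∈A⊕B → summands-≥ (∈-⊕⁻ A B z∈A⊕B)
  }
  where
  summands-≥ : ∀ {z} → (∃₂ λ x y → x ∈ A × y ∈ B × z ≡ x + y) → m + m' ≤ z
  summands-≥ (_ , _ , x∈A , y∈B , refl) = +-mono-≤ (least-≤ least x∈A) (least-≤ least' y∈B)

length-⊕ : ∀ A B → length (A ⊕ B) ≡ length A * length B
length-⊕ []      B = refl
length-⊕ (a ∷ A) B = trans (length-++ (map (a +_) B))
  (cong₂ _+_ (length-map (a +_) B) (length-⊕ A B))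

UniqueSums : List ℕ → List ℕ → Set
UniqueSums A B = ∀ {x x' y y'} → x ∈ A → x' ∈ A → y ∈ B → y' ∈ B → x + y ≡ x' + y' → x ≡ x'

UniqueSums-comm : UniqueSums A B → UniqueSums B A
UniqueSums-comm unique {y} {y'} {x} {x'} y∈B y'∈B x∈A x'∈A eq
  with unique x∈A x'∈A y∈B y'∈B (trans (+-comm x y) (trans eq (+-comm y' x')))
... | refl = +-cancelʳ-≡ x y y' eq

⊕-unique : Unique A → Unique B → UniqueSums A B → Unique (A ⊕ B)
⊕-unique {[]}        _             _     _      = []
⊕-unique {a ∷ A} {B} (a∉A ∷ uniqA) uniqB unique =
  ++⁺ (map⁺ (+-cancelˡ-≡ a _ _) uniqB)
      (⊕-unique uniqA uniqB (λ x∈A x'∈A → unique (there x∈A) (there x'∈A)))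
      disjoint
  where
  disjoint : ∀ {z} → z ∈ map (a +_) B × z ∈ A ⊕ B → ⊥
  disjoint (z∈a+B , z∈A⊕B) with ∈-map⁻ (a +_) z∈a+B | ∈-⊕⁻ A B z∈A⊕B
  ... | y , y∈B , refl | x , y' , x∈A , y'∈B , eq =
    lookup a∉A x∈A (unique (here refl) (there x∈A) y∈B y'∈B eq)

card-unique : ∀ A → Unique A → card A ≡ length A
card-unique A uniq = cong length (deduplicate-unique A uniq)
  where
  deduplicate-unique : ∀ A → Unique A → deduplicate _≟_ A ≡ A
  deduplicate-unique []      _            = refl
  deduplicate-unique (a ∷ A) (a∉A ∷ uniq) =
    cong (a ∷_) (trans (cong (filter (λ x → ¬? (a ≟ x))) (deduplicate-unique A uniq))
                       (filter-all (λ x → ¬? (a ≟ x)) a∉A))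

card-⊕ : Unique A → Unique B → UniqueSums A B → card (A ⊕ B) ≡ card A * card B
card-⊕ {A} {B} uniqA uniqB unique = begin
  card (A ⊕ B)          ≡⟨ card-unique (A ⊕ B) (⊕-unique uniqA uniqB unique) ⟩
  length (A ⊕ B)        ≡⟨ length-⊕ A B ⟩
  length A * length B   ≡⟨ cong₂ _*_ (card-unique A uniqA) (card-unique B uniqB) ⟨
  card A * card B       ∎
  where open ≡-Reasoning

progression : ℕ → ℕ → ℕ → List ℕ
progression s d l = applyUpTo (λ i → s + i * d) l

progression-unique : ∀ s d l .{{_ : NonZero d}} → Unique (progression s d l)
progression-unique s d l = applyUpTo⁺₁ _ l λ {i} {j} i<j _ eq →
  <⇒≢ i<j (*-cancelʳ-≡ i j d (+-cancelˡ-≡ s _ _ eq))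

card-progression : ∀ s d l .{{_ : NonZero d}} → card (progression s d l) ≡ l
card-progression s d l = trans (card-unique _ (progression-unique s d l)) (length-applyUpTo _ l)

IsLeast-progression : ∀ s d l .{{_ : NonZero l}} → IsLeast s (progression s d l)
IsLeast-progression s d l@(suc _) = record
  { least-∈ = here (≡-sym (+-identityʳ s))
  ; least-≤ = λ x∈P → case ∈-applyUpTo⁻ (λ i → s + i * d) x∈P of λ where
      (i , _ , refl) → m≤m+n s (i * d)
  }

-- x + y determines x ∈ [s, s + l) through its residue modulo l, as y ∈ t + l ℕ.
progression-uniqueSums : ∀ s t l l' → UniqueSums (progression s 1 l) (progression t l l')
progression-uniqueSums s t l l' x∈P x'∈P y∈Q y'∈Q eq
  with ∈-applyUpTo⁻ (λ i → s + i * 1) x∈P | ∈-applyUpTo⁻ (λ i → s + i * 1) x'∈P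
     | ∈-applyUpTo⁻ (λ j → t + j * l) y∈Q | ∈-applyUpTo⁻ (λ j → t + j * l) y'∈Q
... | i , i<l , refl | i' , i'<l , refl | j , _ , refl | j' , _ , refl =
  cong (λ i → s + i * 1) (proj₁ (divMod-unique {q = j} {q' = j'} i<l i'<l digits))
  where
  regroup : ∀ s t i j l → (s + i * 1) + (t + j * l) ≡ (s + t) + (i + j * l)
  regroup = solve-∀
  digits : i + j * l ≡ i' + j' * l
  digits = +-cancelˡ-≡ (s + t) _ _
    (trans (≡-sym (regroup s t i j l)) (trans eq (regroup s t i' j' l)))

card-nonZero : A ≢ [] → NonZero (card A)
card-nonZero {[]}    A≢[] = contradiction refl A≢[]
card-nonZero {_ ∷ _} _    = _

module _ (G : Graph) (f : Fin (n G) → List ℕ) where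

  strong∧¬composite⇒weak : ∀ {k} → IsIASI G f → Strong G f → Uniform G k f →
                           ¬ Composite k → Weak G f
  strong∧¬composite⇒weak (nonempty , _) strong uniform ¬composite u v uv =
    trans (strong u v uv)
      (¬composite⇒m*n≡m⊔n (card (f u)) (card (f v))
        (subst (λ k → ¬ Composite k) (trans (≡-sym (uniform u v uv)) (strong u v uv)) ¬composite))
    where instance
      _ = card-nonZero (nonempty u)
      _ = card-nonZero (nonempty v)

  strong∧nontrivial⇒¬weak : Strong G f → (∀ u → 1 < card (f u)) → ¬ Weak G f
  strong∧nontrivial⇒¬weak strong nontrivial weak with hasEdge G
  ... | u , v , uv = <⇒≢ (m⊔n<m*n (nontrivial u) (nontrivial v))
                         (trans (≡-sym (weak u v uv)) (strong u v uv))

module BipartiteLabelling (G : Graph) (bipartite : Bipartite G) (a b : ℕ)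
                          {{_ : NonZero a}} {{_ : NonZero b}} where

  private
    N : ℕ
    N = n G

    colour : Fin N → Bool
    colour = proj₁ bipartite

    proper : ∀ u v → Adj G u v → colour u ≢ colour v
    proper = proj₂ bipartite

  block : Bool → ℕ → List ℕ
  block true  x = progression x 1 a
  block false y = progression (suc y * N) a b

  -- The shift by one keeps every start on the false side above the starts x < N.
  start : Bool → ℕ → ℕ
  start true  x = x
  start false y = suc y * N

  size : Bool → ℕ
  size true  = a
  size false = b

  IsLeast-block : ∀ β x → IsLeast (start β x) (block β x)
  IsLeast-block true  x = IsLeast-progression x 1 a
  IsLeast-block false y = IsLeast-progression (suc y * N) a b

  block-unique : ∀ β x → Unique (block β x)
  block-unique true  x = progression-unique x 1 a
  block-unique false y = progression-unique (suc y * N) a b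

  card-block : ∀ β x → card (block β x) ≡ size β
  card-block true  x = card-progression x 1 a
  card-block false y = card-progression (suc y * N) a b

  block-uniqueSums : ∀ β β' → β ≢ β' → ∀ x y → UniqueSums (block β x) (block β' y)
  block-uniqueSums true  true  β≢β' = contradiction refl β≢β'
  block-uniqueSums false false β≢β' = contradiction refl β≢β'
  block-uniqueSums true  false _ x y = progression-uniqueSums x (suc y * N) a b
  block-uniqueSums false true  _ x y = UniqueSums-comm (progression-uniqueSums y (suc x * N) a b)

  size-*-size : ∀ β β' → β ≢ β' → size β * size β' ≡ a * b
  size-*-size true  true  β≢β' = contradiction refl β≢β'
  size-*-size false false β≢β' = contradiction refl β≢β'
  size-*-size true  false _    = refl
  size-*-size false true  _    = *-comm b a

  <N⇒≢suc*N : x < N → x ≢ suc y * N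
  <N⇒≢suc*N {x} {y} x<N = <⇒≢ (<-≤-trans x<N (m≤m+n N (y * N)))

  start-injective : ∀ β γ → x < N → y < N → start β x ≡ start γ y → x ≡ y
  start-injective true  true  _   _   eq = eq
  start-injective {x} {y} false false x<N _ eq =
    suc-injective (proj₂ (divMod-unique {q = suc x} {q' = suc y} 0<N 0<N eq))
    where 0<N = ≤-<-trans z≤n x<N
  start-injective {x} {y} true false x<N _ eq = contradiction eq (<N⇒≢suc*N {y = y} x<N)
  start-injective {x} {y} false true _ y<N eq = contradiction (≡-sym eq) (<N⇒≢suc*N {y = x} y<N)

  mixed-sum-injective : x < N → x' < N → x + suc y * N ≡ x' + suc y' * N → x ≡ x' × y ≡ y'
  mixed-sum-injective {y = y} {y' = y'} x<N x'<N eq =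
    map₂ suc-injective (divMod-unique {q = suc y} {q' = suc y'} x<N x'<N eq)

  start-sum-injective : ∀ β β' γ γ' → β ≢ β' → γ ≢ γ' → x < N → y < N → x' < N → y' < N →
                        start β x + start β' y ≡ start γ x' + start γ' y' →
                        (x ≡ x' × y ≡ y') ⊎ (x ≡ y' × y ≡ x')
  start-sum-injective true  true  _     _     β≢β' _    = contradiction refl β≢β'
  start-sum-injective false false _     _     β≢β' _    = contradiction refl β≢β'
  start-sum-injective _     _     true  true  _    γ≢γ' = contradiction refl γ≢γ'
  start-sum-injective _     _     false false _    γ≢γ' = contradiction refl γ≢γ'
  start-sum-injective true false true false _ _ x< _ x'< _ eq =
    inj₁ (mixed-sum-injective x< x'< eq)
  start-sum-injective {x} {y} {x'} {y'} true false false true _ _ x< _ _ y'< eq =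
    inj₂ (mixed-sum-injective x< y'< (trans eq (+-comm (suc x' * N) y')))
  start-sum-injective {x} {y} {x'} {y'} false true true false _ _ _ y< x'< _ eq =
    inj₂ (swap (mixed-sum-injective y< x'< (trans (+-comm y (suc x * N)) eq)))
  start-sum-injective {x} {y} {x'} {y'} false true false true _ _ _ y< _ y'< eq =
    inj₁ (swap (mixed-sum-injective y< y'<
      (trans (+-comm y (suc x * N)) (trans eq (+-comm (suc x' * N) y')))))

  labelling : Fin N → List ℕ
  labelling u = block (colour u) (toℕ u)

  labelling-isIASI : IsIASI G labelling
  labelling-isIASI = nonempty , injective , edge-injective
    where
    least : ∀ u → IsLeast (start (colour u) (toℕ u)) (labelling u)
    least u = IsLeast-block (colour u) (toℕ u)

    nonempty : ∀ u → labelling u ≢ []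
    nonempty u = IsLeast⇒≢[] (least u)

    injective : ∀ u v → labelling u ≈ˢ labelling v → u ≡ v
    injective u v fu≈fv = toℕ-injective (start-injective (colour u) (colour v) (toℕ<n u) (toℕ<n v)
      (IsLeast-unique fu≈fv (least u) (least v)))

    edge-injective : ∀ u v u' v' → Adj G u v → Adj G u' v' →
                     (labelling u ⊕ labelling v) ≈ˢ (labelling u' ⊕ labelling v') →
                     (u ≡ u' × v ≡ v') ⊎ (u ≡ v' × v ≡ u')
    edge-injective u v u' v' uv u'v' sums≈ =
      map-⊎ (map-× toℕ-injective toℕ-injective) (map-× toℕ-injective toℕ-injective)
        (start-sum-injective (colour u) (colour v) (colour u') (colour v')
          (proper u v uv) (proper u' v' u'v') (toℕ<n u) (toℕ<n v) (toℕ<n u') (toℕ<n v')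
          (IsLeast-unique sums≈ (IsLeast-⊕ (least u) (least v)) (IsLeast-⊕ (least u') (least v'))))

  labelling-strong : Strong G labelling
  labelling-strong u v uv =
    card-⊕ (block-unique (colour u) (toℕ u)) (block-unique (colour v) (toℕ v))
      (block-uniqueSums (colour u) (colour v) (proper u v uv) (toℕ u) (toℕ v))

  labelling-uniform : Uniform G (a * b) labelling
  labelling-uniform u v uv = begin
    card (labelling u ⊕ labelling v)           ≡⟨ labelling-strong u v uv ⟩
    card (labelling u) * card (labelling v)    ≡⟨ cong₂ _*_ (card-block (colour u) (toℕ u))
                                                                (card-block (colour v) (toℕ v)) ⟩
    size (colour u) * size (colour v)          ≡⟨ size-*-size (colour u) (colour v) (proper u v uv) ⟩
    a * b                                      ∎
    where open ≡-Reasoning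

  labelling-nontrivial : 1 < a → 1 < b → ∀ u → 1 < card (labelling u)
  labelling-nontrivial 1<a 1<b u =
    subst (1 <_) (≡-sym (card-block (colour u) (toℕ u))) (size>1 (colour u))
    where
    size>1 : ∀ β → 1 < size β
    size>1 true  = 1<a
    size>1 false = 1<b

corollary3 : (G : Graph) → Bipartite G → (k : ℕ) → k ≥ 1 →
    (Σ (Fin (n G) → List ℕ) λ f →
        StronglyUniformIASI G k f × ¬ WeaklyUniformIASI G k f)
    ⇔ Composite k
corollary3 G bipartite k _ = mk⇔ strongNotWeak⇒composite composite⇒strongNotWeak
  where
  strongNotWeak⇒composite : (Σ (Fin (n G) → List ℕ) λ f →
                               StronglyUniformIASI G k f × ¬ WeaklyUniformIASI G k f) →
                            Composite k
  strongNotWeak⇒composite (f , (iasi , strong , uniform) , ¬weak) =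
    decidable-stable (composite? k) λ ¬composite →
      ¬weak (iasi , strong∧¬composite⇒weak G f iasi strong uniform ¬composite , uniform)

  composite⇒strongNotWeak : Composite k → Σ (Fin (n G) → List ℕ) λ f →
                              StronglyUniformIASI G k f × ¬ WeaklyUniformIASI G k f
  composite⇒strongNotWeak c with composite⇒nontrivial-product c
  ... | a , b , 1<a , 1<b , refl =
    labelling , (labelling-isIASI , labelling-strong , labelling-uniform) ,
    λ (_ , weak , _) →
      strong∧nontrivial⇒¬weak G labelling labelling-strong (labelling-nontrivial 1<a 1<b) weak
    where
    instance
      _ = >-nonZero (<-trans z<s 1<a)
      _ = >-nonZero (<-trans z<s 1<b)
    open BipartiteLabelling G bipartite a b
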